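{- Let $G=(V,E)$ be a bipartite DAG with $m$ edges, in which every vertex is either a source (no incoming edges) or a target (no outgoing edges), and every edge goes from a source to a target. Let $G'$ be the complete undirected weighted graph whose $m$ vertices are the edges of $G$, where for two distinct edges $e_i,e_j$ of $G$ the weight of the edge $\{e_i,e_j\}$ in $G'$ is $1$ if $e_i$ and $e_j$ have the same target, $2$ if they have the same source, and $3$ if they share no endpoint. Run the following algorithm on $G'$: (1) compute a minimum spanning tree $T$ of $G'$; (2) compute a minimum-cost perfect matching $M$ on the complete subgraph of $G'$ induced by the odd-degree vertices of $T$; (3) take the multigraph $F$ formed by the union of $T$ and $M$, which is Eulerian, and find an Euler tour of $F$; (4) follow this tour, shortcutting repeated vertices, to obtain a Hamiltonian path $P$ of $G'$. Then the total weight of $P$ is at most $\tfrac{21}{8}$ times the minimum total weight of a Hamiltonian path in $G'$.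
   Context: A Hamiltonian path in a graph is a path visiting every vertex exactly once; its cost is the sum of the weights of its edges. Shortcutting a tour means traversing it and skipping any vertex already visited, jumping directly (via the corresponding edge of the complete graph) to the next unvisited vertex. -}

module Defs where

open import Data.Nat using (ℕ; zero; suc; _+_; _*_; _∸_; _≤_; _%_)
open import Data.Fin using (Fin)
open import Data.Fin.Properties using (_≟_)
open import Data.Bool using (if_then_else_)
open import Data.Nat.ListAction using (sum)
open import Data.List using (List; []; _∷_; map; length; last; deduplicate; allFin)
open import Data.List.Relation.Unary.All using (All)
open import Data.List.Relation.Unary.Any using (Any)
open import Data.List.Relation.Binary.Pointwise using (Pointwise)
open import Data.List.Relation.Binary.Permutation.Propositional using (_↭_)
open import Data.Maybe using (just)
open import Data.Product using (_×_; _,_; ∃; ∃-syntax)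
open import Data.Sum using (_⊎_)
open import Relation.Nullary using (yes; no; ⌊_⌋)
open import Relation.Binary.PropositionalEquality using (_≡_; _≢_)

-- Each edge e goes from src e to tgt e.  `simple`: no two distinct edges
-- with the same endpoints (G is a graph, E ⊆ V × V).  `split`: no vertex is
-- both the target of some edge and the source of some edge, i.e. every vertex
-- is a source (no incoming edges) or a target (no outgoing edges); hence G is
-- bipartite, acyclic, and every edge goes from a source to a target.

record BipDAG (n m : ℕ) : Set where
  field
    src    : Fin m → Fin n
    tgt    : Fin m → Fin n
    simple : ∀ e e′ → src e ≡ src e′ → tgt e ≡ tgt e′ → e ≡ e′
    split  : ∀ e e′ → tgt e ≢ src e′

open BipDAG public

-- The weight function of G′ (complete graph on Fin m).  Only used on pairs
-- of distinct vertices (the value on i = j is irrelevant).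

weight : ∀ {n m} → BipDAG n m → Fin m → Fin m → ℕ
weight G i j with tgt G i ≟ tgt G j | src G i ≟ src G j
... | yes _ | _     = 1
... | no _  | yes _ = 2
... | no _  | no _  = 3

-- Edge lists / multigraphs on the vertex set Fin m of G′.
-- An (undirected) edge {i , j} is represented by a pair (i , j).

Edge : ℕ → Set
Edge m = Fin m × Fin m

WeightFn : ℕ → Set
WeightFn m = Fin m → Fin m → ℕ

edgeWeight : ∀ {m} → WeightFn m → Edge m → ℕ
edgeWeight w (i , j) = w i j

totalWeight : ∀ {m} → WeightFn m → List (Edge m) → ℕ
totalWeight w es = sum (map (edgeWeight w) es)

NonLoop : ∀ {m} → Edge m → Set
NonLoop (i , j) = i ≢ j

Adjacent : ∀ {m} → List (Edge m) → Fin m → Fin m → Set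
Adjacent es u v = Any (λ e → (e ≡ (u , v)) ⊎ (e ≡ (v , u))) es

data Reach {m} (es : List (Edge m)) : Fin m → Fin m → Set where
  here : ∀ {u} → Reach es u u
  step : ∀ {u v x} → Adjacent es u v → Reach es v x → Reach es u x

IsSpanningTree : (m : ℕ) → List (Edge m) → Set
IsSpanningTree m T = All NonLoop T × (length T ≡ m ∸ 1) × (∀ u v → Reach T u v)

IsMST : ∀ {m} → WeightFn m → List (Edge m) → Set
IsMST {m} w T =
  IsSpanningTree m T × (∀ T′ → IsSpanningTree m T′ → totalWeight w T ≤ totalWeight w T′)

incid : ∀ {m} → Fin m → Edge m → ℕ
incid v (i , j) = (if ⌊ i ≟ v ⌋ then 1 else 0) + (if ⌊ j ≟ v ⌋ then 1 else 0)

degree : ∀ {m} → List (Edge m) → Fin m → ℕ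
degree es v = sum (map (incid v) es)

OddDeg : ∀ {m} → List (Edge m) → Fin m → Set
OddDeg T v = degree T v % 2 ≡ 1

IsPerfectMatchingOnOdd : ∀ {m} → List (Edge m) → List (Edge m) → Set
IsPerfectMatchingOnOdd T M =
  All (λ e → NonLoop e × OddDeg T (Data.Product.proj₁ e) × OddDeg T (Data.Product.proj₂ e)) M
  × (∀ v → OddDeg T v → degree M v ≡ 1)

IsMinPerfectMatchingOnOdd : ∀ {m} → WeightFn m → List (Edge m) → List (Edge m) → Set
IsMinPerfectMatchingOnOdd w T M =
  IsPerfectMatchingOnOdd T M
  × (∀ M′ → IsPerfectMatchingOnOdd T M′ → totalWeight w M ≤ totalWeight w M′)

steps : ∀ {m} → List (Fin m) → List (Edge m)
steps (x ∷ y ∷ xs) = (x , y) ∷ steps (y ∷ xs)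
steps _            = []

SameEdge : ∀ {m} → Edge m → Edge m → Set
SameEdge (a , b) (c , d) = (a ≡ c × b ≡ d) ⊎ (a ≡ d × b ≡ c)

-- Euler tour of the multigraph F: a closed walk (nonempty vertex sequence whose
-- last vertex equals its first) traversing every edge of F exactly once,
-- i.e. its list of steps is, up to orientation of edges, a permutation of F.
IsEulerTour : ∀ {m} → List (Edge m) → List (Fin m) → Set
IsEulerTour F tour =
  (∃[ v ] ∃[ vs ] (tour ≡ v ∷ vs × last (v ∷ vs) ≡ just v))
  × (∃[ F′ ] (Pointwise SameEdge F F′ × F′ ↭ steps tour))

shortcut : ∀ {m} → List (Fin m) → List (Fin m)
shortcut = deduplicate _≟_

IsHamPath : (m : ℕ) → List (Fin m) → Set
IsHamPath m p = p ↭ allFin m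

pathCost : ∀ {m} → WeightFn m → List (Fin m) → ℕ
pathCost w p = totalWeight w (steps p)

-- The weights of G′ form a metric: they lie in {1, 2, 3}, and weight 1 means
-- "same target", which is transitive. A Hamiltonian path Q is a spanning tree,
-- so w(T) ≤ w(Q). By the handshake lemma T has an even number of odd-degree
-- vertices; pairing them up consecutively in the order in which Q visits them
-- gives a perfect matching of weight at most w(Q) by the triangle inequality,
-- so w(M) ≤ w(Q). The Euler tour of T ∪ M costs w(T) + w(M), and shortcutting
-- does not increase its cost, again by the triangle inequality. Hence w(P) ≤ 2 w(Q), which is stronger than the bound
-- 21/8 w(Q).
module Submission where

open import Defs
open import Algebra.Properties.CommutativeSemigroup using (interchange)
open import Data.Bool using (if_then_else_)
open import Data.Empty using (⊥-elim)
open import Data.Fin using (Fin)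
open import Data.Fin.Properties using (_≟_)
open import Data.List using (List; []; _∷_; _++_; map; length; filter; deduplicate)
open import Data.List.Properties using (map-++; length-tabulate; filter-accept; filter-reject)
open import Data.List.Membership.Propositional using (_∈_)
open import Data.List.Membership.Propositional.Properties using (∈-allFin; ∈-filter⁺; ∈-deduplicate⁺)
open import Data.List.Membership.Propositional.Properties.WithK using (unique∧set⇒bag)
open import Data.List.Relation.Binary.BagAndSetEquality using (∼bag⇒↭)
open import Data.List.Relation.Binary.Permutation.Propositional using (↭-sym; ↭⇒↭ₛ)
open import Data.List.Relation.Binary.Permutation.Propositional.Properties using (Any-resp-↭; ∈-resp-↭; ↭-length; map⁺)
open import Data.List.Relation.Binary.Permutation.Setoid.Properties using (Unique-resp-↭)
open import Data.List.Relation.Binary.Pointwise using (Pointwise; []; _∷_; Any-resp-Pointwise)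
open import Data.List.Relation.Binary.Sublist.Propositional using (_⊆_; []; _∷_; _∷ʳ_; ⊆-trans)
open import Data.List.Relation.Binary.Sublist.Propositional.Properties using (filter-⊆)
open import Data.List.Relation.Unary.All as All using (All; []; _∷_)
open import Data.List.Relation.Unary.All.Properties using (all-filter)
open import Data.List.Relation.Unary.Any as Any using (here; there)
open import Data.List.Relation.Unary.Any.Properties using (++⁺ˡ)
open import Data.List.Relation.Unary.AllPairs using (_∷_)
open import Data.List.Relation.Unary.Unique.Propositional using (Unique)
open import Data.List.Relation.Unary.Unique.Propositional.Properties as Unique using (allFin⁺)
open import Data.List.Relation.Unary.Unique.DecPropositional.Properties using (deduplicate-!)
open import Data.Nat using (ℕ; suc; _+_; _*_; _∸_; _≤_; _%_; z≤n; s≤s)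
open import Data.Nat.DivMod using (%-distribˡ-+; m%n%n≡m%n; m%n<n; m*n%n≡0)
open import Data.Nat.ListAction using (sum)
open import Data.Nat.ListAction.Properties using (sum-++; sum-↭)
open import Data.Nat.Properties as ℕ
  using (≤-refl; ≤-trans; m≤m+n; m≤n+m; +-mono-≤; +-monoˡ-≤; +-monoʳ-≤; +-assoc; +-identityʳ; *-assoc
        ; *-comm; *-suc; *-monoʳ-≤; *-monoˡ-≤; +-commutativeSemigroup)
open import Data.Product using (_×_; _,_; proj₁; proj₂)
open import Data.Sum using (_⊎_; inj₁; inj₂; swap)
open import Function using (_∘_; id)
open import Function.Bundles using (mk⇔)
open import Relation.Binary.Core using (Rel)
open import Relation.Binary.Definitions as B using (_Respects_)
open import Relation.Binary.PropositionalEquality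
open import Relation.Nullary using (Dec; yes; no; ⌊_⌋; ¬?)
open import Relation.Unary using (Pred; Decidable)

private
  variable
    n m : ℕ
    A : Set

Symmetricʷ : WeightFn m → Set
Symmetricʷ w = ∀ i j → w i j ≡ w j i

TriangleInequality : WeightFn m → Set
TriangleInequality w = ∀ i j k → w i k ≤ w i j + w j k

-- Metric properties of the weights of G′

module _ (G : BipDAG n m) where

  1≤weight : ∀ i j → 1 ≤ weight G i j
  1≤weight i j with tgt G i ≟ tgt G j | src G i ≟ src G j
  ... | yes _ | _     = s≤s z≤n
  ... | no _  | yes _ = s≤s z≤n
  ... | no _  | no _  = s≤s z≤n

  weight≤3 : ∀ i j → weight G i j ≤ 3
  weight≤3 i j with tgt G i ≟ tgt G j | src G i ≟ src G j
  ... | yes _ | _     = s≤s z≤n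
  ... | no _  | yes _ = s≤s (s≤s z≤n)
  ... | no _  | no _  = ≤-refl

  sameTarget⇒weight≡1 : ∀ {i j} → tgt G i ≡ tgt G j → weight G i j ≡ 1
  sameTarget⇒weight≡1 {i} {j} t with tgt G i ≟ tgt G j
  ... | yes _ = refl
  ... | no t≢ = ⊥-elim (t≢ t)

  differentTargets⇒2≤weight : ∀ {i j} → tgt G i ≢ tgt G j → 2 ≤ weight G i j
  differentTargets⇒2≤weight {i} {j} t≢ with tgt G i ≟ tgt G j | src G i ≟ src G j
  ... | yes t | _     = ⊥-elim (t≢ t)
  ... | no _  | yes _ = ≤-refl
  ... | no _  | no _  = s≤s (s≤s z≤n)

  weight-sym : Symmetricʷ (weight G)
  weight-sym i j with tgt G i ≟ tgt G j | src G i ≟ src G j | tgt G j ≟ tgt G i | src G j ≟ src G i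
  ... | yes _ | _     | yes _ | _     = refl
  ... | yes t | _     | no t≢ | _     = ⊥-elim (t≢ (sym t))
  ... | no t≢ | _     | yes t | _     = ⊥-elim (t≢ (sym t))
  ... | no _  | yes _ | no _  | yes _ = refl
  ... | no _  | yes s | no _  | no s≢ = ⊥-elim (s≢ (sym s))
  ... | no _  | no s≢ | no _  | yes s = ⊥-elim (s≢ (sym s))
  ... | no _  | no _  | no _  | no _  = refl

  weight-triangle : TriangleInequality (weight G)
  weight-triangle i j k = byTargets (tgt G i ≟ tgt G k) (tgt G i ≟ tgt G j) (tgt G j ≟ tgt G k)
    where
    byTargets : Dec (tgt G i ≡ tgt G k) → Dec (tgt G i ≡ tgt G j) → Dec (tgt G j ≡ tgt G k)
              → weight G i k ≤ weight G i j + weight G j k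
    byTargets (yes ik) _        _        =
      subst (_≤ weight G i j + weight G j k) (sym (sameTarget⇒weight≡1 ik))
            (≤-trans (1≤weight i j) (m≤m+n _ _))
    byTargets (no ik≢) (yes ij) (yes jk) = ⊥-elim (ik≢ (trans ij jk))
    byTargets (no _)   (yes _)  (no jk≢) =
      ≤-trans (weight≤3 i k) (+-mono-≤ (1≤weight i j) (differentTargets⇒2≤weight jk≢))
    byTargets (no _)   (no ij≢) _        =
      ≤-trans (weight≤3 i k) (+-mono-≤ (differentTargets⇒2≤weight ij≢) (1≤weight j k))

-- Shortcutting

deduplicate-⊆ : ∀ {ℓ} {R : Rel A ℓ} (R? : B.Decidable R) xs → deduplicate R? xs ⊆ xs
deduplicate-⊆ R? []       = []
deduplicate-⊆ R? (x ∷ xs) = refl ∷ ⊆-trans (filter-⊆ (¬? ∘ R? x) _) (deduplicate-⊆ R? xs)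

module _ {w : WeightFn m} where

  pathCost-tail : ∀ y ys → pathCost w ys ≤ pathCost w (y ∷ ys)
  pathCost-tail y []       = z≤n
  pathCost-tail y (z ∷ zs) = m≤n+m _ (w y z)

  module _ (triangle : TriangleInequality w) where

    pathCost-bypass : ∀ x y zs → pathCost w (x ∷ zs) ≤ w x y + pathCost w (y ∷ zs)
    pathCost-bypass x y []       = z≤n
    pathCost-bypass x y (z ∷ zs) = begin
      w x z + pathCost w (z ∷ zs)           ≤⟨ +-monoˡ-≤ _ (triangle x y z) ⟩
      w x y + w y z + pathCost w (z ∷ zs)   ≡⟨ +-assoc (w x y) _ _ ⟩
      w x y + pathCost w (y ∷ z ∷ zs)       ∎
      where open ℕ.≤-Reasoning

    pathCost-∷-mono-⊆ : ∀ x {xs ys} → xs ⊆ ys → pathCost w (x ∷ xs) ≤ pathCost w (x ∷ ys)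
    pathCost-∷-mono-⊆ x []               = z≤n
    pathCost-∷-mono-⊆ x {xs} (y ∷ʳ xs⊆ys) =
      ≤-trans (pathCost-bypass x y xs) (+-monoʳ-≤ (w x y) (pathCost-∷-mono-⊆ y xs⊆ys))
    pathCost-∷-mono-⊆ x (refl ∷ xs⊆ys)    = +-monoʳ-≤ (w x _) (pathCost-∷-mono-⊆ _ xs⊆ys)

    pathCost-mono-⊆ : ∀ {xs ys} → xs ⊆ ys → pathCost w xs ≤ pathCost w ys
    pathCost-mono-⊆ []                          = z≤n
    pathCost-mono-⊆ {ys = y ∷ ys} (_ ∷ʳ xs⊆ys) = ≤-trans (pathCost-mono-⊆ xs⊆ys) (pathCost-tail y ys)
    pathCost-mono-⊆ (refl ∷ xs⊆ys)              = pathCost-∷-mono-⊆ _ xs⊆ys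

    pathCost-shortcut : ∀ xs → pathCost w (shortcut xs) ≤ pathCost w xs
    pathCost-shortcut xs = pathCost-mono-⊆ (deduplicate-⊆ _≟_ xs)

-- Hamiltonian paths are spanning trees

hamPath-unique : ∀ {Q} → IsHamPath m Q → Unique Q
hamPath-unique {m} Q↭ = Unique-resp-↭ (setoid (Fin m)) (↭⇒↭ₛ (↭-sym Q↭)) (allFin⁺ m)

hamPath-complete : ∀ {Q} → IsHamPath m Q → ∀ v → v ∈ Q
hamPath-complete Q↭ v = ∈-resp-↭ (↭-sym Q↭) (∈-allFin v)

unique∧complete⇒hamPath : ∀ {Q} → Unique Q → (∀ v → v ∈ Q) → IsHamPath m Q
unique∧complete⇒hamPath {m} uniq complete =
  ∼bag⇒↭ (unique∧set⇒bag uniq (allFin⁺ m) (λ {v} → mk⇔ (λ _ → ∈-allFin v) (λ _ → complete v)))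

module _ {es : List (Edge m)} where

  Adjacent-sym : ∀ {u v} → Adjacent es u v → Adjacent es v u
  Adjacent-sym = Any.map swap

  Reach-trans : ∀ {u v x} → Reach es u v → Reach es v x → Reach es u x
  Reach-trans here         r′ = r′
  Reach-trans (step uv r) r′ = step uv (Reach-trans r r′)

  Reach-sym : ∀ {u v} → Reach es u v → Reach es v u
  Reach-sym here        = here
  Reach-sym (step uv r) = Reach-trans (Reach-sym r) (step (Adjacent-sym uv) here)

  Reach-++⁺ˡ : ∀ {fs u v} → Reach es u v → Reach (es ++ fs) u v
  Reach-++⁺ˡ here        = here
  Reach-++⁺ˡ (step uv r) = step (++⁺ˡ uv) (Reach-++⁺ˡ r)

Reach-∷ : ∀ {e} {es : List (Edge m)} {u v} → Reach es u v → Reach (e ∷ es) u v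
Reach-∷ here        = here
Reach-∷ (step uv r) = step (there uv) (Reach-∷ r)

Reach-steps : ∀ (x : Fin m) xs {u} → u ∈ x ∷ xs → Reach (steps (x ∷ xs)) x u
Reach-steps x xs       (here refl) = here
Reach-steps x (y ∷ ys) (there u∈)  = step (here (inj₁ refl)) (Reach-∷ (Reach-steps y ys u∈))

steps-connected : ∀ {xs : List (Fin m)} → (∀ v → v ∈ xs) → ∀ u v → Reach (steps xs) u v
steps-connected {xs = []}     complete u v with complete u
... | ()
steps-connected {xs = x ∷ xs} complete u v =
  Reach-trans (Reach-sym (Reach-steps x xs (complete u))) (Reach-steps x xs (complete v))

steps-nonLoop : ∀ {xs : List (Fin m)} → Unique xs → All NonLoop (steps xs)
steps-nonLoop {xs = []}         _                 = []
steps-nonLoop {xs = x ∷ []}     _                 = []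
steps-nonLoop {xs = x ∷ y ∷ xs} ((x≢y ∷ _) ∷ uniq) = x≢y ∷ steps-nonLoop uniq

length-steps : ∀ (xs : List (Fin m)) → length (steps xs) ≡ length xs ∸ 1
length-steps []           = refl
length-steps (x ∷ [])     = refl
length-steps (x ∷ y ∷ xs) = cong suc (length-steps (y ∷ xs))

hamPath⇒spanningTree : ∀ {Q} → IsHamPath m Q → IsSpanningTree m (steps Q)
hamPath⇒spanningTree {m} {Q} Q↭ =
  steps-nonLoop (hamPath-unique Q↭) ,
  trans (length-steps Q) (cong (_∸ 1) (trans (↭-length Q↭) (length-tabulate {n = m} id))) ,
  steps-connected (hamPath-complete Q↭)

-- Degree sums

sum-map-+ : ∀ (f g : A → ℕ) xs → sum (map (λ x → f x + g x) xs) ≡ sum (map f xs) + sum (map g xs)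
sum-map-+ f g []       = refl
sum-map-+ f g (x ∷ xs) = begin
  f x + g x + sum (map (λ x → f x + g x) xs)      ≡⟨ cong (f x + g x +_) (sum-map-+ f g xs) ⟩
  f x + g x + (sum (map f xs) + sum (map g xs))   ≡⟨ interchange +-commutativeSemigroup (f x) (g x) _ _ ⟩
  f x + sum (map f xs) + (g x + sum (map g xs))   ∎
  where open ≡-Reasoning

sum-map-zero : ∀ {f : A → ℕ} {xs} → All (λ x → f x ≡ 0) xs → sum (map f xs) ≡ 0
sum-map-zero []              = refl
sum-map-zero (fx≡0 ∷ fxs≡0) = cong₂ _+_ fx≡0 (sum-map-zero fxs≡0)

sum-map-unique : ∀ (f : A → ℕ) {a xs} → Unique xs → a ∈ xs → (∀ x → x ≢ a → f x ≡ 0) →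
                 sum (map f xs) ≡ f a
sum-map-unique f (a∉ ∷ _)  (here refl) f≡0 =
  trans (cong (f _ +_) (sum-map-zero (All.map (λ a≢x → f≡0 _ (a≢x ∘ sym)) a∉))) (+-identityʳ _)
sum-map-unique f {xs = x ∷ xs} (x≢ ∷ uniq) (there a∈) f≡0 =
  trans (cong (_+ sum (map f xs)) (f≡0 x (All.lookup x≢ a∈))) (sum-map-unique f uniq a∈ f≡0)

-- `incid v (i , j)` unfolds to `δ i v + δ j v`.
δ : Fin m → Fin m → ℕ
δ a b = if ⌊ a ≟ b ⌋ then 1 else 0

δ-refl : (a : Fin m) → δ a a ≡ 1
δ-refl a with a ≟ a
... | yes _  = refl
... | no a≢a = ⊥-elim (a≢a refl)

δ-≢ : {a b : Fin m} → a ≢ b → δ a b ≡ 0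
δ-≢ {a = a} {b} a≢b with a ≟ b
... | yes a≡b = ⊥-elim (a≢b a≡b)
... | no _    = refl

sum-δ : ∀ {a} {vs : List (Fin m)} → Unique vs → a ∈ vs → sum (map (δ a) vs) ≡ 1
sum-δ {a = a} uniq a∈ = trans (sum-map-unique (δ a) uniq a∈ (λ x x≢a → δ-≢ (x≢a ∘ sym))) (δ-refl a)

handshake : ∀ {vs : List (Fin m)} → Unique vs → (∀ v → v ∈ vs) →
            ∀ es → sum (map (degree es) vs) ≡ 2 * length es
handshake {vs = vs} uniq complete []           = sum-map-zero (All.universal (λ _ → refl) vs)
handshake {vs = vs} uniq complete ((i , j) ∷ es) = begin
  sum (map (degree ((i , j) ∷ es)) vs)                      ≡⟨ sum-map-+ (λ v → incid v (i , j)) (degree es) vs ⟩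
  sum (map (λ v → δ i v + δ j v) vs) + sum (map (degree es) vs)
    ≡⟨ cong₂ _+_ (sum-map-+ (δ i) (δ j) vs) (handshake uniq complete es) ⟩
  sum (map (δ i) vs) + sum (map (δ j) vs) + 2 * length es
    ≡⟨ cong (λ k → k + 2 * length es) (cong₂ _+_ (sum-δ uniq (complete i)) (sum-δ uniq (complete j))) ⟩
  2 + 2 * length es                                         ≡⟨ sym (*-suc 2 (length es)) ⟩
  2 * length ((i , j) ∷ es)                                 ∎
  where open ≡-Reasoning

odd? : (f : A → ℕ) → Decidable (λ x → f x % 2 ≡ 1)
odd? f x = f x % 2 ℕ.≟ 1

%2≢1⇒%2≡0 : ∀ k → k % 2 ≢ 1 → k % 2 ≡ 0
%2≢1⇒%2≡0 k k%2≢1 with k % 2 | m%n<n k 2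
... | 0           | _               = refl
... | 1           | _               = ⊥-elim (k%2≢1 refl)
... | suc (suc _) | s≤s (s≤s ())

length-filter-odd≡sum-mod-2 : ∀ (f : A → ℕ) xs → length (filter (odd? f) xs) % 2 ≡ sum (map f xs) % 2
length-filter-odd≡sum-mod-2 f []       = refl
length-filter-odd≡sum-mod-2 f (x ∷ xs) with odd? f x
... | yes fx%2≡1 = begin
  length (filter (odd? f) (x ∷ xs)) % 2 ≡⟨ cong (λ ys → length ys % 2) (filter-accept (odd? f) fx%2≡1) ⟩
  suc l % 2                             ≡⟨ %-distribˡ-+ 1 l 2 ⟩
  (1 + l % 2) % 2                       ≡⟨ cong₂ (λ a b → (a + b) % 2) (sym fx%2≡1) (length-filter-odd≡sum-mod-2 f xs) ⟩
  (f x % 2 + s % 2) % 2                 ≡⟨ %-distribˡ-+ (f x) s 2 ⟨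
  (f x + s) % 2                         ∎
  where
  open ≡-Reasoning
  l = length (filter (odd? f) xs)
  s = sum (map f xs)
... | no fx%2≢1 = begin
  length (filter (odd? f) (x ∷ xs)) % 2 ≡⟨ cong (λ ys → length ys % 2) (filter-reject (odd? f) fx%2≢1) ⟩
  length (filter (odd? f) xs) % 2       ≡⟨ length-filter-odd≡sum-mod-2 f xs ⟩
  s % 2                                 ≡⟨ m%n%n≡m%n s 2 ⟨
  s % 2 % 2                             ≡⟨ cong (λ a → (a + s % 2) % 2) (%2≢1⇒%2≡0 (f x) fx%2≢1) ⟨
  (f x % 2 + s % 2) % 2                 ≡⟨ %-distribˡ-+ (f x) s 2 ⟨
  (f x + s) % 2                         ∎
  where
  open ≡-Reasoning
  s = sum (map f xs)

data EvenLength {A : Set} : List A → Set where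
  []    : EvenLength []
  cons₂ : ∀ x y {xs} → EvenLength xs → EvenLength (x ∷ y ∷ xs)

length%2≡0⇒EvenLength : ∀ (xs : List A) → length xs % 2 ≡ 0 → EvenLength xs
length%2≡0⇒EvenLength []           _  = []
-- `(2 + k) % 2` reduces to `k % 2`.
length%2≡0⇒EvenLength (x ∷ y ∷ xs) ev = cons₂ x y (length%2≡0⇒EvenLength xs ev)

oddDegree-evenLength : ∀ (T : List (Edge m)) {vs} → Unique vs → (∀ v → v ∈ vs) →
                       EvenLength (filter (odd? (degree T)) vs)
oddDegree-evenLength T {vs} uniq complete = length%2≡0⇒EvenLength _ (begin
  length (filter (odd? (degree T)) vs) % 2  ≡⟨ length-filter-odd≡sum-mod-2 (degree T) vs ⟩
  sum (map (degree T) vs) % 2               ≡⟨ cong (_% 2) (handshake uniq complete T) ⟩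
  2 * length T % 2                          ≡⟨ cong (_% 2) (*-comm 2 (length T)) ⟩
  length T * 2 % 2                          ≡⟨ m*n%n≡0 (length T) 2 ⟩
  0                                         ∎)
  where open ≡-Reasoning

-- Pairing up the odd-degree vertices

pairUp : List A → List (A × A)
pairUp (x ∷ y ∷ xs) = (x , y) ∷ pairUp xs
pairUp _            = []

degree-pairUp : ∀ {xs : List (Fin m)} → EvenLength xs → ∀ v → degree (pairUp xs) v ≡ sum (map (λ x → δ x v) xs)
degree-pairUp []               v = refl
degree-pairUp (cons₂ x y even) v =
  trans (+-assoc (δ x v) (δ y v) _) (cong (λ k → δ x v + (δ y v + k)) (degree-pairUp even v))

pairUp-all : ∀ {ℓ} {P : Pred (Fin m) ℓ} {xs} → Unique xs → All P xs →
             All (λ e → NonLoop e × P (proj₁ e) × P (proj₂ e)) (pairUp xs)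
pairUp-all {xs = []}         _                   _                = []
pairUp-all {xs = x ∷ []}     _                   _                = []
pairUp-all {xs = x ∷ y ∷ xs} ((x≢y ∷ _) ∷ _ ∷ uniq) (px ∷ py ∷ pxs) = (x≢y , px , py) ∷ pairUp-all uniq pxs

totalWeight-pairUp≤pathCost : ∀ (w : WeightFn m) xs → totalWeight w (pairUp xs) ≤ pathCost w xs
totalWeight-pairUp≤pathCost w []           = z≤n
totalWeight-pairUp≤pathCost w (x ∷ [])     = z≤n
totalWeight-pairUp≤pathCost w (x ∷ y ∷ xs) =
  +-monoʳ-≤ (w x y) (≤-trans (totalWeight-pairUp≤pathCost w xs) (pathCost-tail y xs))

pairUp-oddDegree-isPerfectMatchingOnOdd : ∀ (T : List (Edge m)) {vs} → Unique vs → (∀ v → v ∈ vs) →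
  IsPerfectMatchingOnOdd T (pairUp (filter (odd? (degree T)) vs))
pairUp-oddDegree-isPerfectMatchingOnOdd T {vs} uniq complete =
  pairUp-all uniqOdd (all-filter (odd? (degree T)) vs) ,
  λ v odd → begin
    degree (pairUp odds) v       ≡⟨ degree-pairUp (oddDegree-evenLength T uniq complete) v ⟩
    sum (map (λ x → δ x v) odds) ≡⟨ sum-map-unique (λ x → δ x v) uniqOdd
                                      (∈-filter⁺ (odd? (degree T)) (complete v) odd) (λ _ → δ-≢) ⟩
    δ v v                        ≡⟨ δ-refl v ⟩
    1                            ∎
  where
  open ≡-Reasoning
  odds = filter (odd? (degree T)) vs
  uniqOdd : Unique odds
  uniqOdd = Unique.filter⁺ (odd? (degree T)) uniq

module _ {w : WeightFn m} {T : List (Edge m)} {Q : List (Fin m)} (hamQ : IsHamPath m Q) where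

  mst≤hamPath : IsMST w T → totalWeight w T ≤ pathCost w Q
  mst≤hamPath (_ , minimal) = minimal (steps Q) (hamPath⇒spanningTree hamQ)

  minPerfectMatching≤hamPath : TriangleInequality w → ∀ {M} → IsMinPerfectMatchingOnOdd w T M →
                               totalWeight w M ≤ pathCost w Q
  minPerfectMatching≤hamPath triangle {M} (_ , minimal) = begin
    totalWeight w M                      ≤⟨ minimal (pairUp odds) (pairUp-oddDegree-isPerfectMatchingOnOdd T
                                              (hamPath-unique hamQ) (hamPath-complete hamQ)) ⟩
    totalWeight w (pairUp odds)          ≤⟨ totalWeight-pairUp≤pathCost w odds ⟩
    pathCost w odds                      ≤⟨ pathCost-mono-⊆ triangle (filter-⊆ (odd? (degree T)) Q) ⟩
    pathCost w Q                         ∎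
    where
    open ℕ.≤-Reasoning
    odds = filter (odd? (degree T)) Q

-- Euler tours

joins-resp-SameEdge : ∀ {u v : Fin m} → (λ e → (e ≡ (u , v)) ⊎ (e ≡ (v , u))) Respects SameEdge
joins-resp-SameEdge (inj₁ (refl , refl)) joins        = joins
joins-resp-SameEdge (inj₂ (refl , refl)) (inj₁ refl) = inj₂ refl
joins-resp-SameEdge (inj₂ (refl , refl)) (inj₂ refl) = inj₁ refl

Adjacent-resp-SameEdge : ∀ {F F′ : List (Edge m)} {u v} → Pointwise SameEdge F F′ → Adjacent F u v → Adjacent F′ u v
Adjacent-resp-SameEdge = Any-resp-Pointwise joins-resp-SameEdge

Adjacent-steps⇒∈ : ∀ {xs : List (Fin m)} {u v} → Adjacent (steps xs) u v → u ∈ xs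
Adjacent-steps⇒∈ {xs = x ∷ y ∷ xs} (here (inj₁ refl)) = here refl
Adjacent-steps⇒∈ {xs = x ∷ y ∷ xs} (here (inj₂ refl)) = there (here refl)
Adjacent-steps⇒∈ {xs = x ∷ y ∷ xs} (there adj)        = there (Adjacent-steps⇒∈ adj)

totalWeight-SameEdge : ∀ {w : WeightFn m} → Symmetricʷ w → ∀ {E E′} → Pointwise SameEdge E E′ →
                       totalWeight w E ≡ totalWeight w E′
totalWeight-SameEdge w-sym []                        = refl
totalWeight-SameEdge w-sym (inj₁ (refl , refl) ∷ ps) = cong (_ +_) (totalWeight-SameEdge w-sym ps)
totalWeight-SameEdge w-sym (inj₂ (refl , refl) ∷ ps) = cong₂ _+_ (w-sym _ _) (totalWeight-SameEdge w-sym ps)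

totalWeight-++ : ∀ (w : WeightFn m) E E′ → totalWeight w (E ++ E′) ≡ totalWeight w E + totalWeight w E′
totalWeight-++ w E E′ = trans (cong sum (map-++ (edgeWeight w) E E′)) (sum-++ (map (edgeWeight w) E) _)

eulerTour-covers : ∀ {F : List (Edge m)} {tour} → IsEulerTour F tour → (∀ u v → Reach F u v) → ∀ u → u ∈ tour
eulerTour-covers ((v , _ , refl , _) , _ , pointwise , F′↭tour) connected u with connected u v
... | here       = here refl
... | step adj _ = Adjacent-steps⇒∈ (Any-resp-↭ F′↭tour (Adjacent-resp-SameEdge pointwise adj))

eulerTour-cost : ∀ {w : WeightFn m} {F tour} → Symmetricʷ w → IsEulerTour F tour →
                 pathCost w tour ≡ totalWeight w F
eulerTour-cost {w = w} {F} {tour} w-sym (_ , F′ , pointwise , F′↭tour) = begin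
  totalWeight w (steps tour)  ≡⟨ sum-↭ (map⁺ (edgeWeight w) F′↭tour) ⟨
  totalWeight w F′            ≡⟨ totalWeight-SameEdge w-sym pointwise ⟨
  totalWeight w F             ∎
  where open ≡-Reasoning

-- Christofides' algorithm on a metric

module _ {w : WeightFn m} {T M : List (Edge m)} {tour : List (Fin m)}
         (isMST : IsMST w T) (euler : IsEulerTour (T ++ M) tour) where

  shortcut-isHamPath : IsHamPath m (shortcut tour)
  shortcut-isHamPath = unique∧complete⇒hamPath (deduplicate-! _≟_ tour)
    (∈-deduplicate⁺ _≟_ ∘ eulerTour-covers euler (λ u v → Reach-++⁺ˡ (T-connected u v)))
    where T-connected = proj₂ (proj₂ (proj₁ isMST))

  shortcut-cost≤2*hamPath : Symmetricʷ w → TriangleInequality w → IsMinPerfectMatchingOnOdd w T M →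
                            ∀ {Q} → IsHamPath m Q → pathCost w (shortcut tour) ≤ 2 * pathCost w Q
  shortcut-cost≤2*hamPath w-sym triangle isMinMatching {Q} hamQ = begin
    pathCost w (shortcut tour)           ≤⟨ pathCost-shortcut triangle tour ⟩
    pathCost w tour                      ≡⟨ eulerTour-cost w-sym euler ⟩
    totalWeight w (T ++ M)               ≡⟨ totalWeight-++ w T M ⟩
    totalWeight w T + totalWeight w M    ≤⟨ +-mono-≤ (mst≤hamPath hamQ isMST)
                                                    (minPerfectMatching≤hamPath {T = T} hamQ triangle isMinMatching) ⟩
    pathCost w Q + pathCost w Q          ≡⟨ cong (pathCost w Q +_) (+-identityʳ _) ⟨
    2 * pathCost w Q                     ∎
    where open ℕ.≤-Reasoning

proposition2 : ∀ {n m} (G : BipDAG n m) (T M : List (Edge m)) (tour : List (Fin m))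
    → IsMST (weight G) T
    → IsMinPerfectMatchingOnOdd (weight G) T M
    → IsEulerTour (T ++ M) tour
    → IsHamPath m (shortcut tour)
      × (∀ Q → IsHamPath m Q → 8 * pathCost (weight G) (shortcut tour) ≤ 21 * pathCost (weight G) Q)
proposition2 G T M tour isMST isMinMatching euler =
  shortcut-isHamPath isMST euler , λ Q hamQ → let q = pathCost (weight G) Q in begin
    8 * pathCost (weight G) (shortcut tour)
      ≤⟨ *-monoʳ-≤ 8 (shortcut-cost≤2*hamPath isMST euler (weight-sym G) (weight-triangle G) isMinMatching hamQ) ⟩
    8 * (2 * q)   ≡⟨ *-assoc 8 2 q ⟨
    16 * q        ≤⟨ *-monoˡ-≤ q (m≤m+n 16 5) ⟩
    21 * q        ∎
  where open ℕ.≤-Reasoning
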